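{- For integers $1<k<n$, $f_n(\{k,k+1,\dots,n-1\})=2^{n-1}$.
   Context: The set of alternatives is $[n]=\{1,\dots,n\}$ with its natural order. For a triple $i<j<l$, the never condition $1N3$ on a set of linear orders means that in every order, $i$ is not ranked last among $i,j,l$; $3N1$ means that $l$ is not ranked first among $i,j,l$. For $B\subseteq[n]$, the set-alternating scheme generated by $B$ assigns to each triple $i<j<l$ the condition $1N3$ if $j\in B$ and $3N1$ if $j\notin B$; $D_{[n]}(B)$ is the set of all linear orders on $[n]$ satisfying all assigned conditions, and $f_n(B)=|D_{[n]}(B)|$. -}

module Defs where

open import Data.Bool using (Bool; true; false; _∧_; _∨_; not; if_then_else_)
open import Data.Nat using (ℕ; zero; suc; _<ᵇ_; _≡ᵇ_)
open import Data.Fin using (Fin; toℕ)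
open import Data.List using (List; []; _∷_; [_]; map; concatMap; foldr; filterᵇ; length; allFin)
open import Data.Vec using (Vec; lookup) renaming ([] to []ᵥ; _∷_ to _∷ᵥ_)

-- Alternative x : Fin n stands for the alternative (suc (toℕ x)) ∈ [n] = {1..n};
-- the natural order on [n] is the order of toℕ.
--
-- A linear order on [n] is encoded by its rank vector  pos : Vec (Fin n) n,
-- where  lookup pos x  is the position of alternative x (0 = ranked first,
-- n-1 = ranked last); it must be injective (hence a bijection Fin n → Fin n).

all : {A : Set} → (A → Bool) → List A → Bool
all p = foldr (λ x b → p x ∧ b) true

allVecs : (n m : ℕ) → List (Vec (Fin m) n)
allVecs zero    m = [ []ᵥ ]
allVecs (suc n) m = concatMap (λ x → map (x ∷ᵥ_) (allVecs n m)) (allFin m)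

_<F_ : {m : ℕ} → Fin m → Fin m → Bool
a <F b = toℕ a <ᵇ toℕ b

isRanking : {n : ℕ} → Vec (Fin n) n → Bool
isRanking {n} pos =
  all (λ i → all (λ j → (toℕ i ≡ᵇ toℕ j) ∨ not (toℕ (lookup pos i) ≡ᵇ toℕ (lookup pos j)))
                 (allFin n))
      (allFin n)

-- condition for the triple i < j < l, where B is a subset of labels (ℕ → Bool,
-- membership of the 1-indexed label suc (toℕ j)):
--   j ∈ B : 1N3  (i is not ranked last among i, j, l)
--   j ∉ B : 3N1  (l is not ranked first among i, j, l)
tripleOK : {n : ℕ} → (ℕ → Bool) → Vec (Fin n) n → Fin n → Fin n → Fin n → Bool
tripleOK B pos i j l =
  if B (suc (toℕ j))
  then not ((lookup pos j <F lookup pos i) ∧ (lookup pos l <F lookup pos i))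
  else not ((lookup pos l <F lookup pos i) ∧ (lookup pos l <F lookup pos j))

allTriplesOK : {n : ℕ} → (ℕ → Bool) → Vec (Fin n) n → Bool
allTriplesOK {n} B pos =
  all (λ i → all (λ j → all (λ l →
        not ((i <F j) ∧ (j <F l)) ∨ tripleOK B pos i j l)
      (allFin n)) (allFin n)) (allFin n)

D : (n : ℕ) → (ℕ → Bool) → List (Vec (Fin n) n)
D n B = filterᵇ (λ pos → isRanking pos ∧ allTriplesOK B pos) (allVecs n n)

f : (n : ℕ) → (ℕ → Bool) → ℕ
f n B = length (D n B)

interval : ℕ → ℕ → ℕ → Bool
interval k n j = not (j <ᵇ k) ∧ (j <ᵇ n)

-- Call the labels 2, …, n-1 the middles; B = {k, …, n-1} meets them in an up-set. If n-1 ∈ B,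
-- every triple (x, n-1, n) with x < n-1 carries 1N3, so the alternative ranked last is n-1 or n;
-- removing it leaves an admissible ranking of the other alternatives for the restricted scheme,
-- which is again up-closed, and conversely both n-1 and n can be appended last. If n-1 ∉ B, every
-- triple carries 3N1 and symmetrically the alternative ranked first is 1 or 2. Hence f doubles
-- with each new alternative. Rankings are injective rank vectors; such a vector takes every rank,
-- so summing over the alternative x that holds an extreme rank s counts each ranking once.

module Submission where

open import Defs
open import Data.Nat
  using (ℕ; zero; suc; _+_; _<_; _≤_; _∸_; _^_; _<ᵇ_; _≡ᵇ_; z≤n; s≤s; z<s; s<s; s≤s⁻¹)
open import Relation.Binary.PropositionalEquality
  using (_≡_; _≢_; refl; sym; trans; cong; cong₂; subst; subst₂; ≢-sym; module ≡-Reasoning)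

open import Data.Bool using (Bool; true; false; T; not; _∧_; _∨_)
open import Data.Bool.Properties using (T-∧; T-≡)
open import Data.Empty using (⊥; ⊥-elim)
open import Data.Fin using (Fin; zero; suc; toℕ; punchIn; fromℕ; inject₁)
  renaming (_<_ to _<ᶠ_; _≤_ to _≤ᶠ_)
open import Data.Fin.Properties
  using (toℕ<n; toℕ-injective; toℕ-inject₁; toℕ-fromℕ; suc-injective; 0≢1+n; _≟_; _<?_;
         all?; pigeonhole; punchIn-injective; punchInᵢ≢i; punchIn-mono-≤; punchIn-punchOut;
         ≤∧≢⇒<)
  renaming (<-irrefl to <ᶠ-irrefl; <⇒≢ to <ᶠ⇒≢; <-trans to <ᶠ-trans)
open import Data.List using (List; []; _∷_; _++_; length; map; concatMap; tabulate; filter)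
open import Data.List.Properties using (length-++; filter-++)
import Data.Nat.Properties as ℕₚ
open import Data.Nat.Properties using (<ᵇ⇒<; <⇒<ᵇ; ≡ᵇ⇒≡; ≡⇒≡ᵇ)
open import Data.Product using (_×_; _,_; proj₁; proj₂)
open import Data.Unit using (tt)
open import Data.Vec using (Vec; lookup; insertAt)
  renaming ([] to []ᵥ; _∷_ to _∷ᵥ_; map to mapᵥ)
open import Data.Vec.Functional using (init; last)
open import Data.Vec.Properties using (lookup-map; insertAt-lookup; insertAt-punchIn)
open import Function using (_∘_; _⇔_; mk⇔; Equivalence)
open import Relation.Nullary using (¬_; Dec; yes; no; contradiction; ¬?; _×-dec_; _→-dec_; T?)
open import Relation.Unary using (Pred; Decidable)
open import Level using (0ℓ)

open import Algebra.Properties.CommutativeMonoid.Sum ℕₚ.+-0-commutativeMonoid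
  using (sum; sum-syntax; sum-cong-≗; sum-remove; sum-init-last; sum-replicate-zero;
         ∑-distrib-+; ∑-comm)
open import Algebra.Properties.CommutativeSemigroup ℕₚ.+-commutativeSemigroup
  using (x∙yz≈y∙xz)

open ≡-Reasoning
open Equivalence using (to; from)

sum-zero : ∀ {n} {t : Fin n → ℕ} → (∀ x → t x ≡ 0) → sum t ≡ 0
sum-zero {n} t≡0 = trans (sum-cong-≗ t≡0) (sum-replicate-zero n)

sumVec : ∀ n m → (Vec (Fin m) n → ℕ) → ℕ
sumVec zero    m g = g []ᵥ
sumVec (suc n) m g = ∑[ a < m ] sumVec n m (λ w → g (a ∷ᵥ w))

sumVec-cong : ∀ n m {g h : Vec (Fin m) n → ℕ} → (∀ v → g v ≡ h v) →
  sumVec n m g ≡ sumVec n m h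
sumVec-cong zero    m g≡h = g≡h []ᵥ
sumVec-cong (suc n) m g≡h = sum-cong-≗ (λ a → sumVec-cong n m (λ w → g≡h (a ∷ᵥ w)))

sumVec-zero : ∀ n m {g : Vec (Fin m) n → ℕ} → (∀ v → g v ≡ 0) → sumVec n m g ≡ 0
sumVec-zero zero    m g≡0 = g≡0 []ᵥ
sumVec-zero (suc n) m g≡0 = sum-zero (λ a → sumVec-zero n m (λ w → g≡0 (a ∷ᵥ w)))

𝟙 : {P : Set} → Dec P → ℕ
𝟙 (yes _) = 1
𝟙 (no _)  = 0

𝟙-yes : {P : Set} → P → (P? : Dec P) → 𝟙 P? ≡ 1
𝟙-yes p (yes _) = refl
𝟙-yes p (no ¬p) = contradiction p ¬p

𝟙-no : {P : Set} → ¬ P → (P? : Dec P) → 𝟙 P? ≡ 0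
𝟙-no ¬p (yes p) = contradiction p ¬p
𝟙-no ¬p (no _)  = refl

𝟙-cong : {P Q : Set} → P ⇔ Q → (P? : Dec P) (Q? : Dec Q) → 𝟙 P? ≡ 𝟙 Q?
𝟙-cong P⇔Q (yes p) Q? = sym (𝟙-yes (to P⇔Q p) Q?)
𝟙-cong P⇔Q (no ¬p) Q? = sym (𝟙-no (¬p ∘ from P⇔Q) Q?)

module _ {A B : Set} {P : Pred B 0ℓ} (P? : Decidable P) where

  length-filter-map : ∀ (f : A → B) xs →
    length (filter P? (map f xs)) ≡ length (filter (P? ∘ f) xs)
  length-filter-map f []       = refl
  length-filter-map f (x ∷ xs) with P? (f x)
  ... | yes _ = cong suc (length-filter-map f xs)
  ... | no _  = length-filter-map f xs

  length-filter-concatMap : ∀ {m} (h : A → List B) (t : Fin m → A) →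
    length (filter P? (concatMap h (tabulate t))) ≡ ∑[ x < m ] length (filter P? (h (t x)))
  length-filter-concatMap {zero}  h t = refl
  length-filter-concatMap {suc m} h t = begin
    length (filter P? (first ++ rest))             ≡⟨ cong length (filter-++ P? first rest) ⟩
    length (filter P? first ++ filter P? rest)     ≡⟨ length-++ (filter P? first) ⟩
    length (filter P? first) + length (filter P? rest)
      ≡⟨ cong (length (filter P? first) +_) (length-filter-concatMap h (t ∘ suc)) ⟩
    ∑[ x < suc m ] length (filter P? (h (t x)))   ∎
    where
    first = h (t zero)
    rest  = concatMap h (tabulate (t ∘ suc))

length-filter-allVecs : ∀ n m {P : Pred (Vec (Fin m) n) 0ℓ} (P? : Decidable P) →
  length (filter P? (allVecs n m)) ≡ sumVec n m (𝟙 ∘ P?)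
length-filter-allVecs zero    m P? with P? []ᵥ
... | yes _ = refl
... | no _  = refl
length-filter-allVecs (suc n) m P? = begin
  length (filter P? (concatMap (λ a → map (a ∷ᵥ_) (allVecs n m)) (tabulate (λ a → a))))
    ≡⟨ length-filter-concatMap P? (λ a → map (a ∷ᵥ_) (allVecs n m)) (λ a → a) ⟩
  ∑[ a < m ] length (filter P? (map (a ∷ᵥ_) (allVecs n m)))
    ≡⟨ sum-cong-≗ (λ a → trans (length-filter-map P? (a ∷ᵥ_) (allVecs n m))
                                (length-filter-allVecs n m (P? ∘ (a ∷ᵥ_)))) ⟩
  sumVec (suc n) m (𝟙 ∘ P?) ∎

Ranking : ∀ {n m} → Vec (Fin m) n → Set
Ranking v = ∀ i j → lookup v i ≡ lookup v j → i ≡ j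

-- Ranks are positions (smaller is earlier); b = true is 1N3 and b = false is 3N1.
Obeys : ∀ {m} → Bool → Fin m → Fin m → Fin m → Set
Obeys true  ri rj rl = ¬ (rj <ᶠ ri × rl <ᶠ ri)
Obeys false ri rj rl = ¬ (rl <ᶠ ri × rl <ᶠ rj)

Respects : ∀ {n m} → (Fin n → Bool) → Vec (Fin m) n → Set
Respects β v = ∀ i j l → i <ᶠ j → j <ᶠ l → Obeys (β j) (lookup v i) (lookup v j) (lookup v l)

Valid : ∀ {n m} → (Fin n → Bool) → Vec (Fin m) n → Set
Valid β v = Ranking v × Respects β v

obeys? : ∀ {m} b (ri rj rl : Fin m) → Dec (Obeys b ri rj rl)
obeys? true  ri rj rl = ¬? ((rj <? ri) ×-dec (rl <? ri))
obeys? false ri rj rl = ¬? ((rl <? ri) ×-dec (rl <? rj))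

-- Opaque: unfolding the decision procedure makes conversion checks on #Valid blow up.
opaque
  valid? : ∀ {n m} (β : Fin n → Bool) (v : Vec (Fin m) n) → Dec (Valid β v)
  valid? β v = ranking? ×-dec respects?
    where
    ranking? : Dec (Ranking v)
    ranking? = all? λ i → all? λ j → (lookup v i ≟ lookup v j) →-dec (i ≟ j)
    respects? : Dec (Respects β v)
    respects? = all? λ i → all? λ j → all? λ l →
      (i <? j) →-dec (j <? l) →-dec obeys? (β j) (lookup v i) (lookup v j) (lookup v l)

#Valid : ∀ {n} → (Fin n → Bool) → ℕ
#Valid {n} β = sumVec n n (𝟙 ∘ valid? β)

T-all : ∀ {A : Set} (p : A → Bool) {n} (t : Fin n → A) →
  T (all p (tabulate t)) ⇔ (∀ x → T (p (t x)))
T-all p {zero}  t = mk⇔ (λ _ ()) _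
T-all p {suc n} t = mk⇔ ⇒ ⇐
  where
  ⇒ : T (p (t zero) ∧ all p (tabulate (t ∘ suc))) → ∀ x → T (p (t x))
  ⇒ h zero    = proj₁ (to T-∧ h)
  ⇒ h (suc x) = to (T-all p (t ∘ suc)) (proj₂ (to T-∧ h)) x
  ⇐ : (∀ x → T (p (t x))) → T (p (t zero) ∧ all p (tabulate (t ∘ suc)))
  ⇐ h = from T-∧ (h zero , from (T-all p (t ∘ suc)) (h ∘ suc))

T-∨-not : ∀ a b → T (a ∨ not b) ⇔ (T b → T a)
T-∨-not true  b     = mk⇔ _ _
T-∨-not false true  = mk⇔ (λ ()) (λ h → h tt)
T-∨-not false false = mk⇔ (λ _ ()) _

T-not-∧-∨ : ∀ a b c → T (not (a ∧ b) ∨ c) ⇔ (T a → T b → T c)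
T-not-∧-∨ true  true  c = mk⇔ (λ h _ _ → h) (λ h → h tt tt)
T-not-∧-∨ true  false c = mk⇔ (λ _ _ ()) _
T-not-∧-∨ false b     c = mk⇔ (λ _ ()) _

T-not-<F∧<F : ∀ {m} (a b c d : Fin m) →
  T (not ((a <F b) ∧ (c <F d))) ⇔ (¬ (a <ᶠ b × c <ᶠ d))
T-not-<F∧<F a b c d with toℕ a <ᵇ toℕ b in a<b | toℕ c <ᵇ toℕ d in c<d
... | true  | true  = mk⇔ (λ ())
  (λ h → h (<ᵇ⇒< _ _ (subst T (sym a<b) tt) , <ᵇ⇒< _ _ (subst T (sym c<d) tt)))
... | true  | false = mk⇔ (λ _ (_ , q) → subst T c<d (<⇒<ᵇ q)) _
... | false | _     = mk⇔ (λ _ (p , _) → subst T a<b (<⇒<ᵇ p)) _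

T-≡ᵇ-toℕ : ∀ {m} (a b : Fin m) → T (toℕ a ≡ᵇ toℕ b) ⇔ a ≡ b
T-≡ᵇ-toℕ a b = mk⇔ (toℕ-injective ∘ ≡ᵇ⇒≡ _ _) (≡⇒≡ᵇ _ _ ∘ cong toℕ)

T-isRanking : ∀ {n} (v : Vec (Fin n) n) → T (isRanking v) ⇔ Ranking v
T-isRanking v = mk⇔
  (λ h i j vi≡vj → to (T-≡ᵇ-toℕ i j) (to (entry i j) (to (T-all _ _) (to (T-all _ _) h i) j)
                                                       (from (T-≡ᵇ-toℕ _ _) vi≡vj)))
  (λ ρ → from (T-all _ _) λ i → from (T-all _ _) λ j →
           from (entry i j) (from (T-≡ᵇ-toℕ i j) ∘ ρ i j ∘ to (T-≡ᵇ-toℕ _ _)))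
  where
  entry = λ i j → T-∨-not (toℕ i ≡ᵇ toℕ j) (toℕ (lookup v i) ≡ᵇ toℕ (lookup v j))

T-tripleOK : ∀ {n} B (v : Vec (Fin n) n) i j l →
  T (tripleOK B v i j l) ⇔ Obeys (B (suc (toℕ j))) (lookup v i) (lookup v j) (lookup v l)
T-tripleOK B v i j l with B (suc (toℕ j))
... | true  = T-not-<F∧<F (lookup v j) (lookup v i) (lookup v l) (lookup v i)
... | false = T-not-<F∧<F (lookup v l) (lookup v i) (lookup v l) (lookup v j)

label : ∀ {n} → (ℕ → Bool) → Fin n → Bool
label B j = B (suc (toℕ j))

T-allTriplesOK : ∀ {n} B (v : Vec (Fin n) n) → T (allTriplesOK B v) ⇔ Respects (label B) v
T-allTriplesOK B v = mk⇔
  (λ h i j l i<j j<l → to (T-tripleOK B v i j l)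
     (to (entry i j l) (to (T-all _ _) (to (T-all _ _) (to (T-all _ _) h i) j) l)
         (<⇒<ᵇ i<j) (<⇒<ᵇ j<l)))
  (λ r → from (T-all _ _) λ i → from (T-all _ _) λ j → from (T-all _ _) λ l →
     from (entry i j l) (λ i<j j<l →
       from (T-tripleOK B v i j l) (r i j l (<ᵇ⇒< _ _ i<j) (<ᵇ⇒< _ _ j<l))))
  where
  entry = λ i j l → T-not-∧-∨ (i <F j) (j <F l) (tripleOK B v i j l)

f≡#Valid : ∀ n B → f n B ≡ #Valid (label {n} B)
f≡#Valid n B = begin
  length (filter (T? ∘ validᵇ) (allVecs n n)) ≡⟨ length-filter-allVecs n n (T? ∘ validᵇ) ⟩
  sumVec n n (𝟙 ∘ T? ∘ validᵇ)
    ≡⟨ sumVec-cong n n (λ v → 𝟙-cong (T-valid v) (T? (validᵇ v)) (valid? (label B) v)) ⟩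
  #Valid (label {n} B)                         ∎
  where
  validᵇ : Vec (Fin n) n → Bool
  validᵇ v = isRanking v ∧ allTriplesOK B v
  T-valid : ∀ v → T (validᵇ v) ⇔ Valid (label B) v
  T-valid v = mk⇔
    (λ h → to (T-isRanking v) (proj₁ (to T-∧ h)) , to (T-allTriplesOK B v) (proj₂ (to T-∧ h)))
    (λ (ρ , r) → from T-∧ (from (T-isRanking v) ρ , from (T-allTriplesOK B v) r))

ranking-tail : ∀ {n m} {a : Fin m} {v : Vec (Fin m) n} → Ranking (a ∷ᵥ v) → Ranking v
ranking-tail ρ i j vi≡vj = suc-injective (ρ (suc i) (suc j) vi≡vj)

ranking-map⁻ : ∀ {n m k} (h : Fin m → Fin k) (w : Vec (Fin m) n) →
  Ranking (mapᵥ h w) → Ranking w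
ranking-map⁻ h w ρ i j wi≡wj =
  ρ i j (trans (lookup-map i h w) (trans (cong h wi≡wj) (sym (lookup-map j h w))))

¬ranking-pigeonhole : ∀ {n m} → m < n → (w : Vec (Fin m) n) → ¬ Ranking w
¬ranking-pigeonhole m<n w ρ with pigeonhole m<n (lookup w)
... | i , j , i<j , wi≡wj = <ᶠ-irrefl (ρ i j wi≡wj) i<j

insertRank : ∀ {n m} → Vec (Fin m) n → Fin (suc n) → Fin (suc m) → Vec (Fin (suc m)) (suc n)
insertRank w x s = insertAt (mapᵥ (punchIn s) w) x s

sumVec-avoid : ∀ n {m} (s : Fin (suc m)) {g : Vec (Fin (suc m)) n → ℕ} →
  (∀ v i → lookup v i ≡ s → g v ≡ 0) → sumVec n (suc m) g ≡ sumVec n m (g ∘ mapᵥ (punchIn s))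
sumVec-avoid zero    s g-avoids = refl
sumVec-avoid (suc n) {m} s {g} g-avoids = begin
  ∑[ a < suc m ] column a                     ≡⟨ sum-remove {i = s} column ⟩
  column s + ∑[ y < m ] column (punchIn s y)
    ≡⟨ cong₂ _+_ (sumVec-zero n (suc m) (λ w → g-avoids (s ∷ᵥ w) zero refl))
                 (sum-cong-≗ (λ y → sumVec-avoid n s (λ v i → g-avoids (punchIn s y ∷ᵥ v) (suc i)))) ⟩
  sumVec (suc n) m (g ∘ mapᵥ (punchIn s))     ∎
  where
  column : Fin (suc m) → ℕ
  column a = sumVec n (suc m) (λ w → g (a ∷ᵥ w))

-- An injective vector either avoids the rank s or takes it at exactly one position x.
module _ {m : ℕ} (s : Fin (suc m)) where

  sumVec-split : ∀ n (g : Vec (Fin (suc m)) (suc n) → ℕ) → (∀ v → ¬ Ranking v → g v ≡ 0) →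
    sumVec (suc n) (suc m) g ≡
    sumVec (suc n) m (g ∘ mapᵥ (punchIn s)) + ∑[ x < suc n ] sumVec n m (λ w → g (insertRank w x s))

  sum-punchIn-split : ∀ n (g : Vec (Fin (suc m)) (suc n) → ℕ) → (∀ v → ¬ Ranking v → g v ≡ 0) →
    ∑[ y < m ] sumVec n (suc m) (λ w → g (punchIn s y ∷ᵥ w)) ≡
    sumVec (suc n) m (g ∘ mapᵥ (punchIn s)) + ∑[ x < n ] sumVec n m (λ w → g (insertRank w (suc x) s))

  sumVec-split n g g-ranking = begin
    ∑[ a < suc m ] column a                          ≡⟨ sum-remove {i = s} column ⟩
    column s + ∑[ y < m ] column (punchIn s y)
      ≡⟨ cong₂ _+_ column-s (sum-punchIn-split n g g-ranking) ⟩
    at zero + (avoiding + ∑[ x < n ] at (suc x))     ≡⟨ x∙yz≈y∙xz (at zero) avoiding _ ⟩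
    avoiding + ∑[ x < suc n ] at x                   ∎
    where
    column : Fin (suc m) → ℕ
    column a = sumVec n (suc m) (λ w → g (a ∷ᵥ w))
    at : Fin (suc n) → ℕ
    at x = sumVec n m (λ w → g (insertRank w x s))
    avoiding : ℕ
    avoiding = sumVec (suc n) m (g ∘ mapᵥ (punchIn s))
    column-s : column s ≡ at zero
    column-s = sumVec-avoid n s (λ v i vi≡s →
      g-ranking (s ∷ᵥ v) (λ ρ → 0≢1+n (ρ zero (suc i) (sym vi≡s))))

  sum-punchIn-split zero    g g-ranking = sym (ℕₚ.+-identityʳ _)
  sum-punchIn-split (suc n) g g-ranking = begin
    ∑[ y < m ] sumVec (suc n) (suc m) (λ w → g (punchIn s y ∷ᵥ w))
      ≡⟨ sum-cong-≗ (λ y → sumVec-split n (g ∘ (punchIn s y ∷ᵥ_))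
                                        (λ v ¬ρ → g-ranking _ (¬ρ ∘ ranking-tail))) ⟩
    ∑[ y < m ] (avoiding y + ∑[ x < suc n ] at y x)
      ≡⟨ ∑-distrib-+ avoiding (λ y → ∑[ x < suc n ] at y x) ⟩
    ∑[ y < m ] avoiding y + ∑[ y < m ] ∑[ x < suc n ] at y x
      ≡⟨ cong (∑[ y < m ] avoiding y +_) (∑-comm at) ⟩
    ∑[ y < m ] avoiding y + ∑[ x < suc n ] ∑[ y < m ] at y x ∎
    where
    avoiding : Fin m → ℕ
    avoiding y = sumVec (suc n) m (λ w → g (punchIn s y ∷ᵥ mapᵥ (punchIn s) w))
    at : Fin m → Fin (suc n) → ℕ
    at y x = sumVec n m (λ w → g (punchIn s y ∷ᵥ insertRank w x s))

sumVec-split-square : ∀ n (s : Fin (suc n)) (g : Vec (Fin (suc n)) (suc n) → ℕ) →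
  (∀ v → ¬ Ranking v → g v ≡ 0) →
  sumVec (suc n) (suc n) g ≡ ∑[ x < suc n ] sumVec n n (λ w → g (insertRank w x s))
sumVec-split-square n s g g-ranking =
  trans (sumVec-split s n g g-ranking) (cong (_+ ∑[ x < suc n ] at x) no-avoiding)
  where
  at : Fin (suc n) → ℕ
  at x = sumVec n n (λ w → g (insertRank w x s))
  no-avoiding : sumVec (suc n) n (g ∘ mapᵥ (punchIn s)) ≡ 0
  no-avoiding = sumVec-zero (suc n) n (λ w →
    g-ranking (mapᵥ (punchIn s) w)
              (¬ranking-pigeonhole ℕₚ.≤-refl w ∘ ranking-map⁻ (punchIn s) w))

data PunchInView {n} (x : Fin (suc n)) : Fin (suc n) → Set where
  at      : PunchInView x x
  punched : ∀ y → PunchInView x (punchIn x y)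

punchInView : ∀ {n} (x y : Fin (suc n)) → PunchInView x y
punchInView x y with y ≟ x
... | yes refl = at
... | no y≢x   = subst (PunchInView x) (punchIn-punchOut (y≢x ∘ sym)) (punched _)

punchIn-mono-< : ∀ {n} (i : Fin (suc n)) {j k : Fin n} → j <ᶠ k → punchIn i j <ᶠ punchIn i k
punchIn-mono-< i {j} {k} j<k =
  ≤∧≢⇒< (punchIn-mono-≤ i j k (ℕₚ.<⇒≤ j<k)) (<ᶠ⇒≢ j<k ∘ punchIn-injective i j k)

punchIn-cancel-< : ∀ {n} (i : Fin (suc n)) {j k : Fin n} → punchIn i j <ᶠ punchIn i k → j <ᶠ k
punchIn-cancel-< i {j} {k} p = ℕₚ.≰⇒> (ℕₚ.<⇒≱ p ∘ punchIn-mono-≤ i k j)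

obeys-punchIn : ∀ {m} b (s : Fin (suc m)) {ri rj rl : Fin m} →
  Obeys b ri rj rl ⇔ Obeys b (punchIn s ri) (punchIn s rj) (punchIn s rl)
obeys-punchIn true  s = mk⇔ (λ h (p , q) → h (punchIn-cancel-< s p , punchIn-cancel-< s q))
                            (λ h (p , q) → h (punchIn-mono-< s p , punchIn-mono-< s q))
obeys-punchIn false s = mk⇔ (λ h (p , q) → h (punchIn-cancel-< s p , punchIn-cancel-< s q))
                            (λ h (p , q) → h (punchIn-mono-< s p , punchIn-mono-< s q))

lookup-insertRank : ∀ {n m} (w : Vec (Fin m) n) x s → lookup (insertRank w x s) x ≡ s
lookup-insertRank w x s = insertAt-lookup (mapᵥ (punchIn s) w) x s

lookup-insertRank-punchIn : ∀ {n m} (w : Vec (Fin m) n) x s i →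
  lookup (insertRank w x s) (punchIn x i) ≡ punchIn s (lookup w i)
lookup-insertRank-punchIn w x s i =
  trans (insertAt-punchIn (mapᵥ (punchIn s) w) x s i) (lookup-map i (punchIn s) w)

obeys-insertRank : ∀ {n m} b (w : Vec (Fin m) n) x s i j l → let v = insertRank w x s in
  Obeys b (lookup w i) (lookup w j) (lookup w l) ⇔
  Obeys b (lookup v (punchIn x i)) (lookup v (punchIn x j)) (lookup v (punchIn x l))
obeys-insertRank b w x s i j l
  rewrite lookup-insertRank-punchIn w x s i
        | lookup-insertRank-punchIn w x s j
        | lookup-insertRank-punchIn w x s l = obeys-punchIn b s

ranking-insertRank : ∀ {n m} (w : Vec (Fin m) n) x s → Ranking w → Ranking (insertRank w x s)
ranking-insertRank w x s ρ a b va≡vb with punchInView x a | punchInView x b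
... | at         | at         = refl
... | at         | punched b′ = ⊥-elim (punchInᵢ≢i s (lookup w b′)
      (trans (sym (lookup-insertRank-punchIn w x s b′)) (trans (sym va≡vb) (lookup-insertRank w x s))))
... | punched a′ | at         = ⊥-elim (punchInᵢ≢i s (lookup w a′)
      (trans (sym (lookup-insertRank-punchIn w x s a′)) (trans va≡vb (lookup-insertRank w x s))))
... | punched a′ | punched b′ = cong (punchIn x) (ρ a′ b′ (punchIn-injective s _ _
      (trans (sym (lookup-insertRank-punchIn w x s a′))
             (trans va≡vb (lookup-insertRank-punchIn w x s b′)))))

valid-restrict : ∀ {n m} (β : Fin (suc n) → Bool) (w : Vec (Fin m) n) x s →
  Valid β (insertRank w x s) → Valid (β ∘ punchIn x) w
valid-restrict β w x s (ρ , ok) = ranking , respects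
  where
  ranking : Ranking w
  ranking i j wi≡wj = punchIn-injective x i j (ρ _ _
    (trans (lookup-insertRank-punchIn w x s i)
      (trans (cong (punchIn s) wi≡wj) (sym (lookup-insertRank-punchIn w x s j)))))
  respects : Respects (β ∘ punchIn x) w
  respects i j l i<j j<l = from (obeys-insertRank (β (punchIn x j)) w x s i j l)
    (ok _ _ _ (punchIn-mono-< x i<j) (punchIn-mono-< x j<l))

valid-extend : ∀ {n m} (β : Fin (suc n) → Bool) (w : Vec (Fin m) n) x s →
  let v = insertRank w x s in
  (∀ j l → x <ᶠ j → j <ᶠ l → Obeys (β j) (lookup v x) (lookup v j) (lookup v l)) →
  (∀ i l → i <ᶠ x → x <ᶠ l → Obeys (β x) (lookup v i) (lookup v x) (lookup v l)) →
  (∀ i j → i <ᶠ j → j <ᶠ x → Obeys (β j) (lookup v i) (lookup v j) (lookup v x)) →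
  Valid (β ∘ punchIn x) w → Valid β v
valid-extend β w x s as-first as-middle as-last (ρ , ok) = ranking-insertRank w x s ρ , respects
  where
  respects : Respects β (insertRank w x s)
  respects i j l i<j j<l with punchInView x i | punchInView x j | punchInView x l
  ... | at         | _          | _          = as-first j l i<j j<l
  ... | punched _  | at         | _          = as-middle _ l i<j j<l
  ... | punched _  | punched _  | at         = as-last _ _ i<j j<l
  ... | punched i′ | punched j′ | punched l′ =
    to (obeys-insertRank (β (punchIn x j′)) w x s i′ j′ l′)
       (ok i′ j′ l′ (punchIn-cancel-< x i<j) (punchIn-cancel-< x j<l))

>ᶠ⇒≢ : ∀ {n} {x y : Fin n} → x <ᶠ y → y ≢ x
>ᶠ⇒≢ = ≢-sym ∘ <ᶠ⇒≢

obeys-least-first : ∀ {m} b {ri rj rl : Fin m} → ri <ᶠ rj → ri <ᶠ rl → Obeys b ri rj rl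
obeys-least-first true  ri<rj _     (rj<ri , _) = ℕₚ.<-asym ri<rj rj<ri
obeys-least-first false _     ri<rl (rl<ri , _) = ℕₚ.<-asym ri<rl rl<ri

obeys-least-middle : ∀ {m b} {ri rj rl : Fin m} →
  b ≡ false → rj <ᶠ ri → rj <ᶠ rl → Obeys b ri rj rl
obeys-least-middle refl _ rj<rl (_ , rl<rj) = ℕₚ.<-asym rj<rl rl<rj

disobeys-least-last : ∀ {m b} {ri rj rl : Fin m} →
  b ≡ false → rl <ᶠ ri → rl <ᶠ rj → ¬ Obeys b ri rj rl
disobeys-least-last refl rl<ri rl<rj h = h (rl<ri , rl<rj)

obeys-greatest-last : ∀ {m} b {ri rj rl : Fin m} → ri <ᶠ rl → rj <ᶠ rl → Obeys b ri rj rl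
obeys-greatest-last true  ri<rl _ (_ , rl<ri) = ℕₚ.<-asym ri<rl rl<ri
obeys-greatest-last false ri<rl _ (rl<ri , _) = ℕₚ.<-asym ri<rl rl<ri

obeys-greatest-middle : ∀ {m b} {ri rj rl : Fin m} →
  b ≡ true → ri <ᶠ rj → rl <ᶠ rj → Obeys b ri rj rl
obeys-greatest-middle refl ri<rj _ (rj<ri , _) = ℕₚ.<-asym ri<rj rj<ri

disobeys-greatest-first : ∀ {m b} {ri rj rl : Fin m} →
  b ≡ true → rj <ᶠ ri → rl <ᶠ ri → ¬ Obeys b ri rj rl
disobeys-greatest-first refl rj<ri rl<ri h = h (rj<ri , rl<ri)

insertRank-zero-least : ∀ {n m} (w : Vec (Fin m) n) x {y} → y ≢ x →
  lookup (insertRank w x zero) x <ᶠ lookup (insertRank w x zero) y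
insertRank-zero-least w x {y} y≢x with punchInView x y
... | at = ⊥-elim (y≢x refl)
... | punched y′ rewrite lookup-insertRank w x zero | lookup-insertRank-punchIn w x zero y′ = z<s

punchIn-fromℕ-< : ∀ {m} (j : Fin m) → punchIn (fromℕ m) j <ᶠ fromℕ m
punchIn-fromℕ-< zero    = z<s
punchIn-fromℕ-< (suc j) = s<s (punchIn-fromℕ-< j)

insertRank-fromℕ-greatest : ∀ {n m} (w : Vec (Fin m) n) x {y} → y ≢ x →
  lookup (insertRank w x (fromℕ m)) y <ᶠ lookup (insertRank w x (fromℕ m)) x
insertRank-fromℕ-greatest {m = m} w x {y} y≢x with punchInView x y
... | at = ⊥-elim (y≢x refl)
... | punched y′
  rewrite lookup-insertRank w x (fromℕ m) | lookup-insertRank-punchIn w x (fromℕ m) y′ =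
  punchIn-fromℕ-< (lookup w y′)

valid-extend-least : ∀ {n m} (β : Fin (suc n) → Bool) (w : Vec (Fin m) n) x →
  (∀ {i j} → i <ᶠ j → j <ᶠ x → ⊥) →
  (∀ {i l} → i <ᶠ x → x <ᶠ l → β x ≡ false) →
  Valid (β ∘ punchIn x) w → Valid β (insertRank w x zero)
valid-extend-least β w x nothing-below middle-false = valid-extend β w x zero
  (λ j l x<j j<l → obeys-least-first (β j) (least (>ᶠ⇒≢ x<j)) (least (>ᶠ⇒≢ (<ᶠ-trans x<j j<l))))
  (λ i l i<x x<l → obeys-least-middle (middle-false i<x x<l) (least (<ᶠ⇒≢ i<x)) (least (>ᶠ⇒≢ x<l)))
  (λ i j i<j j<x → ⊥-elim (nothing-below i<j j<x))
  where least = insertRank-zero-least w x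

invalid-extend-least : ∀ {n m} (β : Fin (suc n) → Bool) (w : Vec (Fin m) n) x {i j} →
  i <ᶠ j → j <ᶠ x → β j ≡ false → ¬ Valid β (insertRank w x zero)
invalid-extend-least β w x i<j j<x βj≡false (_ , ok) =
  disobeys-least-last βj≡false (least (<ᶠ⇒≢ (<ᶠ-trans i<j j<x))) (least (<ᶠ⇒≢ j<x))
    (ok _ _ x i<j j<x)
  where least = insertRank-zero-least w x

valid-extend-greatest : ∀ {n m} (β : Fin (suc n) → Bool) (w : Vec (Fin m) n) x →
  (∀ {j l} → x <ᶠ j → j <ᶠ l → ⊥) →
  (∀ {i l} → i <ᶠ x → x <ᶠ l → β x ≡ true) →
  Valid (β ∘ punchIn x) w → Valid β (insertRank w x (fromℕ m))
valid-extend-greatest β w x nothing-above middle-true = valid-extend β w x _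
  (λ j l x<j j<l → ⊥-elim (nothing-above x<j j<l))
  (λ i l i<x x<l → obeys-greatest-middle (middle-true i<x x<l) (greatest (<ᶠ⇒≢ i<x))
                                         (greatest (>ᶠ⇒≢ x<l)))
  (λ i j i<j j<x → obeys-greatest-last (β j) (greatest (<ᶠ⇒≢ (<ᶠ-trans i<j j<x)))
                                             (greatest (<ᶠ⇒≢ j<x)))
  where greatest = insertRank-fromℕ-greatest w x

invalid-extend-greatest : ∀ {n m} (β : Fin (suc n) → Bool) (w : Vec (Fin m) n) x {j l} →
  x <ᶠ j → j <ᶠ l → β j ≡ true → ¬ Valid β (insertRank w x (fromℕ m))
invalid-extend-greatest β w x x<j j<l βj≡true (_ , ok) =
  disobeys-greatest-first βj≡true (greatest (>ᶠ⇒≢ x<j)) (greatest (>ᶠ⇒≢ (<ᶠ-trans x<j j<l)))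
    (ok x _ _ x<j j<l)
  where greatest = insertRank-fromℕ-greatest w x

#ValidAt : ∀ {n} → (Fin (suc n) → Bool) → Fin (suc n) → Fin (suc n) → ℕ
#ValidAt {n} β x s = sumVec n n (λ w → 𝟙 (valid? β (insertRank w x s)))

#Valid-split : ∀ {n} (β : Fin (suc n) → Bool) s → #Valid β ≡ ∑[ x < suc n ] #ValidAt β x s
#Valid-split {n} β s =
  sumVec-split-square n s (𝟙 ∘ valid? β) (λ v ¬ρ → 𝟙-no (¬ρ ∘ proj₁) (valid? β v))

#ValidAt-least : ∀ {n} (β : Fin (suc n) → Bool) x →
  (∀ {i j} → i <ᶠ j → j <ᶠ x → ⊥) →
  (∀ {i l} → i <ᶠ x → x <ᶠ l → β x ≡ false) →
  #ValidAt β x zero ≡ #Valid (β ∘ punchIn x)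
#ValidAt-least β x nothing-below middle-false = sumVec-cong _ _ (λ w → 𝟙-cong
  (mk⇔ (valid-restrict β w x zero) (valid-extend-least β w x nothing-below middle-false)) _ _)

#ValidAt-least-blocked : ∀ {n} (β : Fin (suc n) → Bool) x {i j} →
  i <ᶠ j → j <ᶠ x → β j ≡ false → #ValidAt β x zero ≡ 0
#ValidAt-least-blocked β x i<j j<x βj≡false =
  sumVec-zero _ _ (λ w → 𝟙-no (invalid-extend-least β w x i<j j<x βj≡false) _)

#ValidAt-greatest : ∀ {n} (β : Fin (suc n) → Bool) x →
  (∀ {j l} → x <ᶠ j → j <ᶠ l → ⊥) →
  (∀ {i l} → i <ᶠ x → x <ᶠ l → β x ≡ true) →
  #ValidAt β x (fromℕ n) ≡ #Valid (β ∘ punchIn x)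
#ValidAt-greatest β x nothing-above middle-true = sumVec-cong _ _ (λ w → 𝟙-cong
  (mk⇔ (valid-restrict β w x _) (valid-extend-greatest β w x nothing-above middle-true)) _ _)

#ValidAt-greatest-blocked : ∀ {n} (β : Fin (suc n) → Bool) x {j l} →
  x <ᶠ j → j <ᶠ l → β j ≡ true → #ValidAt β x (fromℕ n) ≡ 0
#ValidAt-greatest-blocked β x x<j j<l βj≡true =
  sumVec-zero _ _ (λ w → 𝟙-no (invalid-extend-greatest β w x x<j j<l βj≡true) _)

#Valid-single : (β : Fin 1 → Bool) → #Valid β ≡ 1
#Valid-single β = cong (_+ 0) (𝟙-yes (ranking , respects) (valid? β (zero ∷ᵥ []ᵥ)))
  where
  ranking : Ranking {1} {1} (zero ∷ᵥ []ᵥ)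
  ranking zero zero _ = refl
  respects : Respects β (zero ∷ᵥ []ᵥ)
  respects zero zero _ ()

sum-first-two : ∀ {n} (t : Fin (suc (suc n)) → ℕ) → (∀ x → 2 ≤ toℕ x → t x ≡ 0) →
  sum t ≡ t zero + t (suc zero)
sum-first-two {n} t t≡0 = begin
  t zero + (t (suc zero) + ∑[ x < n ] t (suc (suc x)))
    ≡⟨ cong (λ r → t zero + (t (suc zero) + r)) (sum-zero (λ x → t≡0 (suc (suc x)) (s≤s (s≤s z≤n)))) ⟩
  t zero + (t (suc zero) + 0)
    ≡⟨ cong (t zero +_) (ℕₚ.+-identityʳ _) ⟩
  t zero + t (suc zero) ∎

sum-last-two : ∀ {n} (t : Fin (suc (suc n)) → ℕ) → (∀ x → toℕ x < n → t x ≡ 0) →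
  sum t ≡ t (inject₁ (fromℕ n)) + t (fromℕ (suc n))
sum-last-two {n} t t≡0 = begin
  sum t                                        ≡⟨ sum-init-last t ⟩
  sum (init t) + last t                        ≡⟨ cong (_+ last t) (sum-init-last (init t)) ⟩
  sum (init (init t)) + last (init t) + last t
    ≡⟨ cong (λ r → r + last (init t) + last t) (sum-zero below) ⟩
  t (inject₁ (fromℕ n)) + t (fromℕ (suc n))   ∎
  where
  below : ∀ x → init (init t) x ≡ 0
  below x = t≡0 _ (subst (_< n) (sym (trans (toℕ-inject₁ (inject₁ x)) (toℕ-inject₁ x))) (toℕ<n x))

-- Position t carries the label suc (toℕ t), so the middles are the labels 2, …, n-1.
Middle : ∀ {n} → Fin n → Set
Middle {n} t = 0 < toℕ t × suc (toℕ t) < n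

UpClosed : ∀ {n} → (Fin n → Bool) → Set
UpClosed β = ∀ {i j} → Middle i → Middle j → i ≤ᶠ j → β i ≡ true → β j ≡ true

middle-between : ∀ {n} {i x l : Fin n} → i <ᶠ x → x <ᶠ l → Middle x
middle-between {l = l} i<x x<l = ℕₚ.≤-<-trans z≤n i<x , ℕₚ.≤-<-trans x<l (toℕ<n l)

toℕ-punchIn-< : ∀ {n} (x : Fin (suc n)) (t : Fin n) → t <ᶠ x → toℕ (punchIn x t) ≡ toℕ t
toℕ-punchIn-< (suc x) zero    _         = refl
toℕ-punchIn-< (suc x) (suc t) (s<s t<x) = cong suc (toℕ-punchIn-< x t t<x)

toℕ-punchIn-≥ : ∀ {n} (x : Fin (suc n)) (t : Fin n) → x ≤ᶠ t →
  toℕ (punchIn x t) ≡ suc (toℕ t)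
toℕ-punchIn-≥ zero    t       _         = refl
toℕ-punchIn-≥ (suc x) (suc t) (s≤s x≤t) = cong suc (toℕ-punchIn-≥ x t x≤t)

upClosed-middlesFalse : ∀ {n} {β : Fin n → Bool} →
  (∀ {t} → Middle t → β t ≡ false) → UpClosed β
upClosed-middlesFalse middles-false mi _ _ βi≡true =
  contradiction (trans (sym βi≡true) (middles-false mi)) λ ()

middle-punchIn-low : ∀ {n} {x : Fin (suc (suc n))} {t : Fin (suc n)} →
  toℕ x ≤ 1 → Middle t → Middle (punchIn x t)
middle-punchIn-low {x = x} {t} x≤1 (0<t , t+1<n+1)
  rewrite toℕ-punchIn-≥ x t (ℕₚ.≤-trans x≤1 0<t) = z<s , s<s t+1<n+1

upClosed-punchIn-high : ∀ {n} {β : Fin (suc (suc n)) → Bool} {x} →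
  n ≤ toℕ x → UpClosed β → UpClosed (β ∘ punchIn x)
upClosed-punchIn-high {n} {β} {x} n≤x up mi mj i≤j =
  up (raise mi) (raise mj) (subst₂ _≤_ (sym (unmoved mi)) (sym (unmoved mj)) i≤j)
  where
  unmoved : ∀ {t} → Middle {suc n} t → toℕ (punchIn x t) ≡ toℕ t
  unmoved (_ , t+1<n+1) = toℕ-punchIn-< x _ (ℕₚ.<-≤-trans (s≤s⁻¹ t+1<n+1) n≤x)
  raise : ∀ {t} → Middle {suc n} t → Middle (punchIn x t)
  raise mt@(0<t , t+1<n+1) rewrite unmoved mt = 0<t , ℕₚ.m<n⇒m<1+n t+1<n+1

toℕ-inject₁-fromℕ : ∀ n → toℕ (inject₁ (fromℕ n)) ≡ n
toℕ-inject₁-fromℕ n = trans (toℕ-inject₁ (fromℕ n)) (toℕ-fromℕ n)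

module _ {n : ℕ} (#Valid-ih : ∀ (β : Fin (suc n) → Bool) → UpClosed β → #Valid β ≡ 2 ^ n) where

  double : 2 ^ n + 2 ^ n ≡ 2 ^ suc n
  double = cong (2 ^ n +_) (sym (ℕₚ.+-identityʳ (2 ^ n)))

  #Valid-middlesFalse : (β : Fin (suc (suc n)) → Bool) →
    (∀ {t} → Middle t → β t ≡ false) → #Valid β ≡ 2 ^ suc n
  #Valid-middlesFalse β middles-false = begin
    #Valid β                                           ≡⟨ #Valid-split β zero ⟩
    ∑[ x < suc (suc n) ] #ValidAt β x zero             ≡⟨ sum-first-two _ blocked ⟩
    #ValidAt β zero zero + #ValidAt β (suc zero) zero
      ≡⟨ cong₂ _+_ (first-two zero z≤n) (first-two (suc zero) ℕₚ.≤-refl) ⟩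
    2 ^ n + 2 ^ n                                      ≡⟨ double ⟩
    2 ^ suc n                                          ∎
    where
    blocked : ∀ x → 2 ≤ toℕ x → #ValidAt β x zero ≡ 0
    blocked x 1<x = #ValidAt-least-blocked β x {zero} {suc zero} z<s 1<x
      (middles-false (middle-between z<s 1<x))
    first-two : ∀ x → toℕ x ≤ 1 → #ValidAt β x zero ≡ 2 ^ n
    first-two x x≤1 = trans
      (#ValidAt-least β x
        (λ i<j j<x → ℕₚ.n≮0 (ℕₚ.<-≤-trans i<j (s≤s⁻¹ (ℕₚ.≤-trans j<x x≤1))))
        (λ i<x x<l → middles-false (middle-between i<x x<l)))
      (#Valid-ih _ (upClosed-middlesFalse (middles-false ∘ middle-punchIn-low x≤1)))

  #Valid-topTrue : (β : Fin (suc (suc n)) → Bool) → UpClosed β →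
    β (inject₁ (fromℕ n)) ≡ true → #Valid β ≡ 2 ^ suc n
  #Valid-topTrue β up top-true = begin
    #Valid β                                              ≡⟨ #Valid-split β (fromℕ (suc n)) ⟩
    ∑[ x < suc (suc n) ] #ValidAt β x (fromℕ (suc n))     ≡⟨ sum-last-two _ blocked ⟩
    #ValidAt β (inject₁ (fromℕ n)) (fromℕ (suc n)) + #ValidAt β (fromℕ (suc n)) (fromℕ (suc n))
      ≡⟨ cong₂ _+_ (last-two _ (ℕₚ.≤-reflexive (sym (toℕ-inject₁-fromℕ n))))
                   (last-two _ (subst (n ≤_) (sym (toℕ-fromℕ (suc n))) (ℕₚ.n≤1+n n))) ⟩
    2 ^ n + 2 ^ n                                         ≡⟨ double ⟩
    2 ^ suc n                                             ∎
    where
    blocked : ∀ x → toℕ x < n → #ValidAt β x (fromℕ (suc n)) ≡ 0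
    blocked x x<n = #ValidAt-greatest-blocked β x
      (subst (toℕ x <_) (sym (toℕ-inject₁-fromℕ n)) x<n)
      (subst₂ _<_ (sym (toℕ-inject₁-fromℕ n)) (sym (toℕ-fromℕ (suc n))) (ℕₚ.n<1+n n))
      top-true
    nothing-above : ∀ {x j l} → n ≤ toℕ x → x <ᶠ j → j <ᶠ l → ⊥
    nothing-above {l = l} n≤x x<j j<l =
      ℕₚ.<⇒≱ (toℕ<n l) (ℕₚ.≤-trans (s≤s (s≤s n≤x)) (ℕₚ.≤-trans (s≤s x<j) j<l))
    middle-is-top : ∀ {i x l} → n ≤ toℕ x → i <ᶠ x → x <ᶠ l → inject₁ (fromℕ n) ≡ x
    middle-is-top n≤x i<x x<l = toℕ-injective (trans (toℕ-inject₁-fromℕ n)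
      (ℕₚ.≤-antisym n≤x (s≤s⁻¹ (s≤s⁻¹ (proj₂ (middle-between i<x x<l))))))
    last-two : ∀ x → n ≤ toℕ x → #ValidAt β x (fromℕ (suc n)) ≡ 2 ^ n
    last-two x n≤x = trans
      (#ValidAt-greatest β x (nothing-above n≤x)
        (λ i<x x<l → subst (λ t → β t ≡ true) (middle-is-top n≤x i<x x<l) top-true))
      (#Valid-ih _ (upClosed-punchIn-high n≤x up))

topFalse⇒middlesFalse : ∀ {n} {β : Fin (suc (suc n)) → Bool} → UpClosed β →
  β (inject₁ (fromℕ n)) ≡ false → ∀ {t} → Middle t → β t ≡ false
topFalse⇒middlesFalse {n} {β} up top-false {t} mt@(0<t , t+1<n+2) with β t in βt
... | false = refl
... | true  = contradiction (trans (sym (up mt top-middle t≤top βt)) top-false) λ ()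
  where
  t≤n : toℕ t ≤ n
  t≤n = s≤s⁻¹ (s≤s⁻¹ t+1<n+2)
  t≤top : t ≤ᶠ inject₁ (fromℕ n)
  t≤top = subst (toℕ t ≤_) (sym (toℕ-inject₁-fromℕ n)) t≤n
  top-middle : Middle (inject₁ (fromℕ n))
  top-middle rewrite toℕ-inject₁-fromℕ n = ℕₚ.<-≤-trans 0<t t≤n , ℕₚ.≤-refl

#Valid-upClosed : ∀ n (β : Fin (suc n) → Bool) → UpClosed β → #Valid β ≡ 2 ^ n
#Valid-upClosed zero    β _  = #Valid-single β
#Valid-upClosed (suc n) β up with β (inject₁ (fromℕ n)) in top
... | true  = #Valid-topTrue (#Valid-upClosed n) β up top
... | false = #Valid-middlesFalse (#Valid-upClosed n) β (topFalse⇒middlesFalse up top)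

T-interval : ∀ k n t → T (interval k n t) ⇔ (k ≤ t × t < n)
T-interval k n t with t <ᵇ k in t<ᵇk
... | true  = mk⇔ (λ ()) (λ (k≤t , _) → ℕₚ.<⇒≱ (<ᵇ⇒< t k (subst T (sym t<ᵇk) tt)) k≤t)
... | false = mk⇔ (λ t<ᵇn → ℕₚ.≮⇒≥ (λ t<k → subst T t<ᵇk (<⇒<ᵇ t<k)) , <ᵇ⇒< t n t<ᵇn)
                  (<⇒<ᵇ ∘ proj₂)

upClosed-interval : ∀ k n → UpClosed (label {n} (interval k n))
upClosed-interval k n {i} {j} _ (_ , j+1<n) i≤j βi≡true = to T-≡
  (from (T-interval k n (suc (toℕ j))) (ℕₚ.≤-trans k≤i+1 (s≤s i≤j) , j+1<n))
  where
  k≤i+1 : k ≤ suc (toℕ i)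
  k≤i+1 = proj₁ (to (T-interval k n (suc (toℕ i))) (from T-≡ βi≡true))

mainTheorem11 : (k n : ℕ) → 1 < k → k < n → f n (interval k n) ≡ 2 ^ (n ∸ 1)
mainTheorem11 k zero    _ ()
mainTheorem11 k (suc n) _ _ = begin
  f (suc n) (interval k (suc n))              ≡⟨ f≡#Valid (suc n) (interval k (suc n)) ⟩
  #Valid (label {suc n} (interval k (suc n))) ≡⟨ #Valid-upClosed n _ (upClosed-interval k (suc n)) ⟩
  2 ^ n                                       ∎
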